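{- Let Agents $=\{A,B\}$ and let $p,q$ be atomic sentences. The $\mathcal L_1(\Sigma_{\mathrm{Pub}})$ sentence $\langle\mathrm{Pub}\ p\rangle\Diamond^*_{A,B}q$ is not expressible by any set of sentences of $\mathcal L_1$, even on the class of state models in which $\to_A$ and $\to_B$ are equivalence relations: there is no set $T\subseteq\mathcal L_1$ such that for every state model $\mathbf S$ with $\to_A,\to_B$ equivalence relations and every $s\in S$, $s\in[\![\langle\mathrm{Pub}\ p\rangle\Diamond^*_{A,B}q]\!]_{\mathbf S}$ iff $s\in[\![\psi]\!]_{\mathbf S}$ for all $\psi\in T$.
   Context: A state model is $\mathbf S=(S,\to_A,\to_B,\|\cdot\|)$ with $\to_A,\to_B$ binary relations on the set $S$ and $\|p\|\subseteq S$ for atomic $p$. $\mathcal L_1$ is multi-agent modal logic with common knowledge: sentences $\mathsf{true}\mid p\mid\neg\varphi\mid\varphi\wedge\psi\mid\Box_A\varphi\mid\Box_B\varphi\mid\Box^*_{\mathcal B}\varphi$ for nonempty $\mathcal B\subseteq\{A,B\}$, where $\Box^*_{\mathcal B}$ quantifies over the reflexive-transitive closure of $\bigcup_{C\in\mathcal B}\to_C$. $\Sigma_{\mathrm{Pub}}$ is the action signature with one action type Pub and $\mathrm{Pub}\to_A\mathrm{Pub}$, $\mathrm{Pub}\to_B\mathrm{Pub}$. Semantics of the sentence: $s\in[\![\langle\mathrm{Pub}\ p\rangle\Diamond^*_{A,B}q]\!]_{\mathbf S}$ iff $s\in\|p\|$ and there is a path $s=s_0\to_{C_1}s_1\to_{C_2}\cdots\to_{C_k}s_k$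 ($k\ge0$, $C_i\in\{A,B\}$) with all $s_i\in\|p\|$ and $s_k\in\|q\|$. -}

module Defs where

open import Data.Nat using (ℕ)
open import Data.Product using (_×_; Σ; ∃)
open import Data.Sum using (_⊎_)
open import Data.Empty using (⊥)
open import Data.Unit using (⊤)
open import Relation.Nullary using (¬_)
open import Relation.Binary using (IsEquivalence)
open import Relation.Binary.Construct.Closure.ReflexiveTransitive using (Star)

AtProp : Set
AtProp = ℕ

data Agent : Set where
  A B : Agent

-- Nonempty subsets 𝓑 ⊆ {A,B}: {A}, {B}, {A,B}.
data Group : Set where
  gA gB gAB : Group

_∈G_ : Agent → Group → Set
A ∈G gA  = ⊤
B ∈G gA  = ⊥
A ∈G gB  = ⊥
B ∈G gB  = ⊤
_ ∈G gAB = ⊤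

record StateModel : Set₁ where
  field
    St  : Set
    rel : Agent → St → St → Set
    val : AtProp → St → Set

open StateModel public

IsEquivModel : StateModel → Set
IsEquivModel M = (a : Agent) → IsEquivalence (rel M a)

data Formula : Set where
  true   : Formula
  atom   : AtProp → Formula
  ¬'_    : Formula → Formula
  _∧'_   : Formula → Formula → Formula
  □      : Agent → Formula → Formula
  □*     : Group → Formula → Formula

groupRel : (M : StateModel) → Group → St M → St M → Set
groupRel M g s t = Σ Agent (λ C → C ∈G g × rel M C s t)

_,_⊨_ : (M : StateModel) → St M → Formula → Set
M , s ⊨ true     = ⊤
M , s ⊨ atom p   = val M p s
M , s ⊨ (¬' φ)   = ¬ (M , s ⊨ φ)
M , s ⊨ (φ ∧' ψ) = (M , s ⊨ φ) × (M , s ⊨ ψ)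
M , s ⊨ □ a φ    = ∀ t → rel M a s t → M , t ⊨ φ
M , s ⊨ □* g φ   = ∀ t → Star (groupRel M g) s t → M , t ⊨ φ

pStep : (M : StateModel) → AtProp → St M → St M → Set
pStep M p s t = (rel M A s t ⊎ rel M B s t) × val M p t

-- s ∈ [[⟨Pub p⟩ ◇*_{A,B} q]]_S : s ∈ ‖p‖ and there is a path
-- s = s₀ →_{C₁} s₁ … →_{C_k} s_k with all s_i ∈ ‖p‖ and s_k ∈ ‖q‖.
PubDiamond : (M : StateModel) → AtProp → AtProp → St M → Set
PubDiamond M p q s = val M p s × ∃ (λ t → Star (pStep M p) s t × val M q t)

-- The counter-model consists of chains of states (m , 1), (m , 2), … linked alternately
-- by →_B and →_A, each with a hub (m , 0) that is →_B-linked to (m , 1); all hubs form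
-- a single →_A-class, so the model is connected.  Every state except the hubs satisfies p,
-- and q holds at the single state (just n , suc n) of chain just n; chain nothing has no
-- q-state.  Since hubs are not p-states, a p-path never leaves its chain, so
-- ⟨Pub p⟩◇*_{A,B} q holds at (just n , 1) but fails at (nothing , 1).  On a connected
-- model □*_{A,B} φ has the same truth value everywhere, so a formula is invariant under
-- k-bisimulation once its depth, counting □*_{A,B} as 0, is at most k; and (just n , 1)
-- is k-bisimilar to (nothing , 1) as soon as n > k.

module Submission where

open import Defs
open import Data.Product using (Σ)
open import Relation.Nullary using (¬_)
open import Relation.Binary.PropositionalEquality using (_≢_)
open import Function.Bundles using (_⇔_)

open import Data.Nat using (ℕ; zero; suc; _+_; _≤_; _≤′_; ≤′-refl; ≤′-step; z≤n; s≤s; ⌊_/2⌋; _⊔_)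
open import Data.Nat.Properties
  using ( ≤-trans; ≤-refl; ≤-reflexive; +-suc; +-monoˡ-≤; m≤m+n; <-irrefl; suc-injective
        ; m≤m⊔n; m≤n⊔m; ≤⇒≤′)
open import Data.Maybe using (Maybe; nothing; just)
open import Data.Product using (_×_; _,_; ∃-syntax)
open import Data.Sum using (_⊎_; inj₁; inj₂)
open import Data.Empty using (⊥; ⊥-elim)
open import Data.Unit using (⊤; tt)
open import Relation.Binary using (IsEquivalence)
open import Function.Bundles using (module Equivalence)
open import Relation.Binary.PropositionalEquality using (_≡_; refl; sym; trans; cong)
open import Relation.Binary.Construct.Closure.ReflexiveTransitive as RTC
  using (Star; ε; _◅_; _◅◅_; fold; reverse)

_,_⊨*_ : (M : StateModel) → St M → (Formula → Set) → Set
M , s ⊨* T = (ψ : Formula) → T ψ → M , s ⊨ ψ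

only : Agent → Group
only A = gA
only B = gB

∈G-only : ∀ {a C} → C ∈G only a → C ≡ a
∈G-only {A} {A} _ = refl
∈G-only {B} {B} _ = refl

Connected : StateModel → Set
Connected M = ∀ s t → Star (groupRel M gAB) s t

-- □*_{A,B} counts as depth 0: this is sound only on connected models.
depth : Formula → ℕ
depth true       = 0
depth (atom _)   = 0
depth (¬' φ)     = depth φ
depth (φ ∧' ψ)   = depth φ ⊔ depth ψ
depth (□ _ φ)    = suc (depth φ)
depth (□* gA φ)  = suc (depth φ)
depth (□* gB φ)  = suc (depth φ)
depth (□* gAB φ) = 0

record GradedBisimulation (M : StateModel) : Set₁ where
  field
    Z         : ℕ → St M → St M → Set
    symmetric : ∀ {k s t} → Z k s t → Z k t s
    atoms     : ∀ {k s t} p → Z k s t → val M p s → val M p t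
    forth     : ∀ {k s t s′} a → Z (suc k) s t → rel M a s s′ →
                ∃[ t′ ] rel M a t t′ × Z k s′ t′

module _ (M : StateModel) (equiv : IsEquivModel M) where

  star-only⇒rel : ∀ a {s t} → Star (groupRel M (only a)) s t → rel M a s t
  star-only⇒rel a = fold (rel M a) step (IsEquivalence.refl (equiv a))
    where
    step : ∀ {s t u} → groupRel M (only a) s t → rel M a t u → rel M a s u
    step (C , C∈ , s→t) with ∈G-only {a} C∈
    ... | refl = IsEquivalence.trans (equiv a) s→t

  □⇒□*-only : ∀ a φ {s} → M , s ⊨ □ a φ → M , s ⊨ □* (only a) φ
  □⇒□*-only a φ h t path = h t (star-only⇒rel a path)

  □*-only⇒□ : ∀ a φ {s} → M , s ⊨ □* (only a) φ → M , s ⊨ □ a φ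
  □*-only⇒□ A φ h t s→t = h t ((A , tt , s→t) ◅ ε)
  □*-only⇒□ B φ h t s→t = h t ((B , tt , s→t) ◅ ε)

  module _ (connected : Connected M) (bisim : GradedBisimulation M) where
    open GradedBisimulation bisim

    bisim-invariant : ∀ φ {k s t} → depth φ ≤ k → Z k s t → M , s ⊨ φ → M , t ⊨ φ
    bisim-invariant-□ : ∀ a φ {k s t} → depth φ ≤ k → Z (suc k) s t →
                        M , s ⊨ □ a φ → M , t ⊨ □ a φ

    bisim-invariant true     _ _ _ = tt
    bisim-invariant (atom p) _ z h = atoms p z h
    bisim-invariant (¬' φ)   d z h = λ ht → h (bisim-invariant φ d (symmetric z) ht)
    bisim-invariant (φ ∧' ψ) d z (hφ , hψ) =
      bisim-invariant φ (≤-trans (m≤m⊔n (depth φ) (depth ψ)) d) z hφ ,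
      bisim-invariant ψ (≤-trans (m≤n⊔m (depth φ) (depth ψ)) d) z hψ
    bisim-invariant (□ a φ)    (s≤s d) z h = bisim-invariant-□ a φ d z h
    bisim-invariant (□* gA φ)  (s≤s d) z h =
      □⇒□*-only A φ (bisim-invariant-□ A φ d z (□*-only⇒□ A φ h))
    bisim-invariant (□* gB φ)  (s≤s d) z h =
      □⇒□*-only B φ (bisim-invariant-□ B φ d z (□*-only⇒□ B φ h))
    bisim-invariant (□* gAB φ) {s = s} _ _ h t _ = h t (connected s t)

    bisim-invariant-□ a φ d z h t′ t→t′ with forth a (symmetric z) t→t′
    ... | s′ , s→s′ , z′ = bisim-invariant φ d (symmetric z′) (h s′ s→s′)

    ⊨*-limit : ∀ {T} (s : ℕ → St M) t → (∀ k → Z k (s k) t) →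
               (∀ k → M , s k ⊨* T) → M , t ⊨* T
    ⊨*-limit s t z h ψ Tψ = bisim-invariant ψ ≤-refl (z (depth ψ)) (h (depth ψ) ψ Tψ)

⌊/2⌋≡⇒≤suc : ∀ i j → ⌊ i /2⌋ ≡ ⌊ j /2⌋ → j ≤ suc i
⌊/2⌋≡⇒≤suc i zero _ = z≤n
⌊/2⌋≡⇒≤suc i (suc zero) _ = s≤s z≤n
⌊/2⌋≡⇒≤suc zero (suc (suc j)) ()
⌊/2⌋≡⇒≤suc (suc zero) (suc (suc j)) ()
⌊/2⌋≡⇒≤suc (suc (suc i)) (suc (suc j)) e = s≤s (s≤s (⌊/2⌋≡⇒≤suc i j (suc-injective e)))

HalfStable : ℕ → Set
HalfStable i = ⌊ i /2⌋ ≡ ⌊ suc i /2⌋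

halfStable⊎halfStable-pred : ∀ i → HalfStable i ⊎ ∃[ j ] i ≡ suc j × HalfStable j
halfStable⊎halfStable-pred zero = inj₁ refl
halfStable⊎halfStable-pred (suc i) with halfStable⊎halfStable-pred i
... | inj₁ e = inj₂ (i , refl , e)
... | inj₂ (j , refl , e) = inj₁ (cong suc e)

-- nothing is the chain without q; on chain just n, q sits at position suc n.
Chain : Set
Chain = Maybe ℕ

Point : Set
Point = Chain × ℕ

data Cell : Set where
  hubs : Cell
  cell : Chain → ℕ → Cell

cell-injective : ∀ {m m′ b b′} → cell m b ≡ cell m′ b′ → m ≡ m′ × b ≡ b′
cell-injective refl = refl , refl

-- The →_a-class of a point; taking the relations to be kernels of this map makes them
-- equivalences for free.
cellOf : Agent → Point → Cell
cellOf A (m , zero)  = hubs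
cellOf A (m , suc i) = cell m ⌊ i /2⌋
cellOf B (m , i)     = cell m ⌊ i /2⌋

-- No q-state of chain m lies within k positions above i.
FarFromQ : ℕ → Chain → ℕ → Set
FarFromQ k nothing  i = ⊤
FarFromQ k (just n) i = i + k ≤ n

farFromQ-down : ∀ {k} m {i j} → j ≤ suc i → FarFromQ (suc k) m i → FarFromQ k m j
farFromQ-down nothing  _ _ = tt
farFromQ-down (just n) {i} j≤1+i far =
  ≤-trans (≤-trans (+-monoˡ-≤ _ j≤1+i) (≤-reflexive (sym (+-suc i _)))) far

farFromQ⇒≢ : ∀ {k m i} → FarFromQ k m (suc i) → m ≢ just i
farFromQ⇒≢ {k} {just n} far refl = <-irrefl refl (≤-trans (s≤s (m≤m+n n k)) far)

data Twins (k : ℕ) : Point → Point → Set where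
  same : ∀ {x} → Twins k x x
  far  : ∀ {m m′ i} → FarFromQ k m i → FarFromQ k m′ i → Twins k (m , i) (m′ , i)

twins-sym : ∀ {k x y} → Twins k x y → Twins k y x
twins-sym same = same
twins-sym (far f f′) = far f′ f

twins-forth : ∀ {k x y x′} a → Twins (suc k) x y → cellOf a x ≡ cellOf a x′ →
              ∃[ y′ ] cellOf a y ≡ cellOf a y′ × Twins k x′ y′
twins-forth {x′ = x′} a same e = x′ , e , same
twins-forth {x′ = m₂ , zero} A (far {i = zero} f f′) e = (m₂ , zero) , refl , same
twins-forth {x′ = _ , zero} A (far {i = suc i} f f′) ()
twins-forth {x′ = _ , suc j} A (far {i = zero} f f′) ()
twins-forth {x′ = _ , suc j} A (far {m} {m′} {suc i} f f′) e with cell-injective e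
... | refl , h = (m′ , suc j) , cong (cell m′) h ,
      far (farFromQ-down m (s≤s j≤1+i) f) (farFromQ-down m′ (s≤s j≤1+i) f′)
  where j≤1+i = ⌊/2⌋≡⇒≤suc i j h
twins-forth {x′ = _ , j} B (far {m} {m′} {i} f f′) e with cell-injective e
... | refl , h = (m′ , j) , cong (cell m′) h ,
      far (farFromQ-down m j≤1+i f) (farFromQ-down m′ j≤1+i f′)
  where j≤1+i = ⌊/2⌋≡⇒≤suc i j h

module ChainModel (p q : AtProp) where

  valuation : AtProp → Point → Set
  valuation r (m , zero)  = ⊥
  valuation r (m , suc i) = r ≡ p ⊎ (r ≡ q × m ≡ just i)

  W : StateModel
  W = record { St = Point ; rel = λ a x y → cellOf a x ≡ cellOf a y ; val = valuation }

  W-equiv : IsEquivModel W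
  W-equiv a = record { refl = refl ; sym = sym ; trans = trans }

  twins-atoms : ∀ {k x y} r → Twins k x y → valuation r x → valuation r y
  twins-atoms r same v = v
  twins-atoms {x = _ , suc _} r (far f f′) (inj₁ r≡p) = inj₁ r≡p
  twins-atoms {x = _ , suc _} r (far f f′) (inj₂ (_ , onQ)) = ⊥-elim (farFromQ⇒≢ f onQ)

  twins : GradedBisimulation W
  twins = record { Z = Twins ; symmetric = twins-sym ; atoms = twins-atoms ; forth = twins-forth }

  climbStep : ∀ m i → pStep W p (m , i) (m , suc i)
  climbStep m i with halfStable⊎halfStable-pred i
  ... | inj₁ e = inj₂ (cong (cell m) e) , inj₁ refl
  ... | inj₂ (j , refl , e) = inj₁ (cong (cell m) e) , inj₁ refl

  climb : ∀ m {i j} → i ≤′ j → Star (pStep W p) (m , i) (m , j)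
  climb m ≤′-refl = ε
  climb m (≤′-step {j} i≤j) = climb m i≤j ◅◅ (climbStep m j ◅ ε)

  pStep⇒groupRel : ∀ {x y} → pStep W p x y → groupRel W gAB x y
  pStep⇒groupRel (inj₁ x→y , _) = A , tt , x→y
  pStep⇒groupRel (inj₂ x→y , _) = B , tt , x→y

  groupRel-sym : ∀ {x y} → groupRel W gAB x y → groupRel W gAB y x
  groupRel-sym (C , C∈ , x→y) = C , C∈ , sym x→y

  fromHub : ∀ m i → Star (groupRel W gAB) (m , 0) (m , i)
  fromHub m i = RTC.map pStep⇒groupRel (climb m (≤⇒≤′ z≤n))

  W-connected : Connected W
  W-connected (m , i) (m′ , j) =
    reverse groupRel-sym (fromHub m i) ◅◅ (A , tt , refl) ◅ fromHub m′ j

  pubDiamond-q : ∀ n → PubDiamond W p q (just n , 1)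
  pubDiamond-q n =
    inj₁ refl , (just n , suc n) , climb (just n) (≤⇒≤′ (s≤s z≤n)) , inj₂ (refl , refl)

  twins-q-free : ∀ k → Twins k (just (suc k) , 1) (nothing , 1)
  twins-q-free k = far ≤-refl tt

  OnQFreeChain : Point → Set
  OnQFreeChain (nothing , suc _) = ⊤
  OnQFreeChain _                 = ⊥

  -- A p-step never enters position 0, and off position 0 both cells record the chain.
  pStep-q-free : ∀ {x y} → OnQFreeChain x → pStep W p x y → OnQFreeChain y
  pStep-q-free {y = _ , zero} _ (_ , ())
  pStep-q-free {nothing , suc _} {_ , suc _} _ (inj₁ e , _) with cell-injective e
  ... | refl , _ = tt
  pStep-q-free {nothing , suc _} {_ , suc _} _ (inj₂ e , _) with cell-injective e
  ... | refl , _ = tt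

  ¬pubDiamond-q-free : p ≢ q → ¬ PubDiamond W p q (nothing , 1)
  ¬pubDiamond-q-free p≢q (_ , y , path , qy) = noQ y (stays path tt) qy
    where
    stays : ∀ {x y} → Star (pStep W p) x y → OnQFreeChain x → OnQFreeChain y
    stays = fold (λ x y → OnQFreeChain x → OnQFreeChain y)
                 (λ s f o → f (pStep-q-free o s)) (λ o → o)
    noQ : ∀ y → OnQFreeChain y → valuation q y → ⊥
    noQ (nothing , suc _) _ (inj₁ q≡p) = p≢q (sym q≡p)
    noQ (nothing , suc _) _ (inj₂ (_ , ()))

mainTheorem5 : (p q : AtProp) → p ≢ q →
    ¬ Σ (Formula → Set) (λ T →
    (M : StateModel) → IsEquivModel M → (s : St M) →
    PubDiamond M p q s ⇔ ((ψ : Formula) → T ψ → M , s ⊨ ψ))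
mainTheorem5 p q p≢q (T , defines) =
  ¬pubDiamond-q-free p≢q (from (defines W W-equiv (nothing , 1)) theory-at-q-free)
  where
  open ChainModel p q
  open Equivalence using (to; from)
  theory-at-q-free : W , (nothing , 1) ⊨* T
  theory-at-q-free =
    ⊨*-limit W W-equiv W-connected twins (λ k → just (suc k) , 1) (nothing , 1) twins-q-free
      (λ k → to (defines W W-equiv (just (suc k) , 1)) (pubDiamond-q (suc k)))
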